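{- Let $Q_n(x,y,z,t)$ be defined by $Q_1=1$, $Q_{n+1}=[x+nz+(y+t)(n+y\partial_y)]Q_n$, and define $Q_{n,k}(x,t)$ by $Q_n(x,y,1,t)=\sum_{k=0}^{n-1}Q_{n,k}(x,t)y^k$, with $Q_{n,k}=0$ if $k\ge n$ or $k<0$. Then for $n\geq 2$ and $0\leq k\leq n-1$, $$Q_{n,k}(x,t)-Q_{n,k}(x-t-1,t)=(t+1)(n+k-1)Q_{n-1,k}(x,t).$$ -}

module Defs where

open import Data.Nat using (ℕ; zero; suc)
open import Data.Integer using (ℤ; +_; _+_; _*_; _-_)
open import Data.List using (List; []; _∷_)

-- A coefficient: an integer polynomial in (x, z, t), represented as the
-- function it induces on ℤ³ (over the infinite domain ℤ, identities of such
-- functions are identities of polynomials).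
Coef : Set
Coef = ℤ → ℤ → ℤ → ℤ

-- A polynomial in y with coefficients in Coef: list of coefficients,
-- lowest degree first;  [c₀, c₁, …] stands for Σ_k c_k(x,z,t) y^k.
PolyY : Set
PolyY = List Coef

_⊕_ : PolyY → PolyY → PolyY
[] ⊕ q = q
(c ∷ p) ⊕ [] = c ∷ p
(c ∷ p) ⊕ (d ∷ q) = (λ x z t → c x z t + d x z t) ∷ (p ⊕ q)

scale : Coef → PolyY → PolyY
scale f [] = []
scale f (c ∷ p) = (λ x z t → f x z t * c x z t) ∷ scale f p

mulY : PolyY → PolyY
mulY p = (λ x z t → + 0) ∷ p

-- the operator (m + y ∂_y): coefficient of y^k is multiplied by (m + k)
nPlusYDy : ℕ → PolyY → PolyY
nPlusYDy m [] = []
nPlusYDy m (c ∷ p) = (λ x z t → + m * c x z t) ∷ nPlusYDy (suc m) p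

L : ℕ → PolyY → PolyY
L n p = scale (λ x z t → x + (+ n) * z) p ⊕ (mulY r ⊕ scale (λ x z t → t) r)
  where r = nPlusYDy n p

-- Q n = Q_n(x,y,z,t) for n ≥ 1:  Q_1 = 1,  Q_{n+1} = L_n Q_n.
-- (Q 0 is a dummy value, never used.)
Q : ℕ → PolyY
Q zero = []
Q (suc zero) = (λ x z t → + 1) ∷ []
Q (suc (suc n)) = L (suc n) (Q (suc n))

coeff : PolyY → ℕ → Coef
coeff [] k = λ x z t → + 0
coeff (c ∷ p) zero = c
coeff (c ∷ p) (suc k) = coeff p k

Qnk : ℕ → ℕ → ℤ → ℤ → ℤ
Qnk n k x t = coeff (Q n) k x (+ 1) t

{-# OPTIONS --safe #-}
-- Write Δf(x) = f(x) − f(x − t − 1). At z = 1 the recurrence reads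
-- Q_{n+1,k} = w_{n,k}(x) Q_{n,k} + (n + k − 1) Q_{n,k−1} with the weight
-- w_{n,k}(x) = x + n + t(n + k), and w_{n,k}(x) − w_{n,k}(x − t − 1) = t + 1 = w_{n,k} − w_{n−1,k}.
-- Applying Δ to the recurrence gives
-- ΔQ_{n+1,k} = w_{n−1,k} ΔQ_{n,k} + (t + 1) Q_{n,k} + (n + k − 1) ΔQ_{n,k−1};
-- inserting the induction hypothesis for ΔQ_{n,k} and ΔQ_{n,k−1} and folding the
-- recurrence for Q_{n,k} back leaves (t + 1)(n + k) Q_{n,k}.
-- The induction on n starts at n = 2 and runs over all k at once: both sides vanish
-- for k ≥ n.
module Submission where

open import Defs
open import Data.List using ([]; _∷_)
open import Data.Nat using (ℕ; _≤_; _∸_; zero; suc; s≤s)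
import Data.Nat as ℕ
import Data.Nat.Properties as ℕ
open import Data.Integer using (ℤ; +_; _+_; _*_; _-_)
import Data.Integer.Properties as ℤ
open import Data.Integer.Tactic.RingSolver using (solve-∀; solve)
open import Relation.Binary.PropositionalEquality
  using (_≡_; refl; sym; trans; cong; cong₂; module ≡-Reasoning)
open ≡-Reasoning

coeff-⊕ : ∀ p q k x z t → coeff (p ⊕ q) k x z t ≡ coeff p k x z t + coeff q k x z t
coeff-⊕ []      q       k       x z t = sym (ℤ.+-identityˡ _)
coeff-⊕ (c ∷ p) []      k       x z t = sym (ℤ.+-identityʳ _)
coeff-⊕ (c ∷ p) (d ∷ q) zero    x z t = refl
coeff-⊕ (c ∷ p) (d ∷ q) (suc k) x z t = coeff-⊕ p q k x z t

coeff-scale : ∀ f p k x z t → coeff (scale f p) k x z t ≡ f x z t * coeff p k x z t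
coeff-scale f []      k       x z t = sym (ℤ.*-zeroʳ (f x z t))
coeff-scale f (c ∷ p) zero    x z t = refl
coeff-scale f (c ∷ p) (suc k) x z t = coeff-scale f p k x z t

coeff-nPlusYDy : ∀ m p k x z t → coeff (nPlusYDy m p) k x z t ≡ + (m ℕ.+ k) * coeff p k x z t
coeff-nPlusYDy m []      k       x z t = sym (ℤ.*-zeroʳ (+ (m ℕ.+ k)))
coeff-nPlusYDy m (c ∷ p) zero    x z t = cong (λ j → + j * c x z t) (sym (ℕ.+-identityʳ m))
coeff-nPlusYDy m (c ∷ p) (suc k) x z t =
  trans (coeff-nPlusYDy (suc m) p k x z t) (cong (λ j → + j * coeff p k x z t) (sym (ℕ.+-suc m k)))

weight : ℕ → ℕ → Coef
weight n k x z t = x + + n * z + t * + (n ℕ.+ k)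

coeff-L : ∀ n p k x z t →
  coeff (L n p) k x z t ≡ weight n k x z t * coeff p k x z t + coeff (mulY (nPlusYDy n p)) k x z t
coeff-L n p k x z t = begin
  coeff (L n p) k x z t
    ≡⟨ coeff-⊕ (scale (λ x z t → x + + n * z) p) (mulY r ⊕ scale (λ x z t → t) r) k x z t ⟩
  coeff (scale (λ x z t → x + + n * z) p) k x z t + coeff (mulY r ⊕ scale (λ x z t → t) r) k x z t
    ≡⟨ cong₂ _+_ (coeff-scale (λ x z t → x + + n * z) p k x z t) (coeff-⊕ (mulY r) (scale (λ x z t → t) r) k x z t) ⟩
  (x + + n * z) * pₖ + (lower + coeff (scale (λ x z t → t) r) k x z t)
    ≡⟨ cong (λ u → (x + + n * z) * pₖ + (lower + u))
            (trans (coeff-scale (λ x z t → t) r k x z t) (cong (t *_) (coeff-nPlusYDy n p k x z t))) ⟩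
  (x + + n * z) * pₖ + (lower + t * (+ (n ℕ.+ k) * pₖ))
    ≡⟨ regroup x (+ n) z t (+ (n ℕ.+ k)) pₖ lower ⟩
  weight n k x z t * pₖ + lower ∎
  where
  regroup : ∀ x N z t K p l → (x + N * z) * p + (l + t * (K * p)) ≡ (x + N * z + t * K) * p + l
  regroup = solve-∀
  r = nPlusYDy n p
  pₖ = coeff p k x z t
  lower = coeff (mulY r) k x z t

lowerTerm : ℕ → ℕ → ℤ → ℤ → ℤ
lowerTerm n zero    x t = + 0
lowerTerm n (suc k) x t = + (n ℕ.+ k) * Qnk n k x t

Qnk-suc : ∀ n k x t →
  Qnk (suc (suc n)) k x t ≡ weight (suc n) k x (+ 1) t * Qnk (suc n) k x t + lowerTerm (suc n) k x t
Qnk-suc n k x t =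
  trans (coeff-L (suc n) (Q (suc n)) k x (+ 1) t)
        (cong (λ u → weight (suc n) k x (+ 1) t * Qnk (suc n) k x t + u) (lower≡lowerTerm k))
  where
  lower≡lowerTerm : ∀ k → coeff (mulY (nPlusYDy (suc n) (Q (suc n)))) k x (+ 1) t ≡ lowerTerm (suc n) k x t
  lower≡lowerTerm zero    = refl
  lower≡lowerTerm (suc k) = coeff-nPlusYDy (suc n) (Q (suc n)) k x (+ 1) t

weight-suc : ∀ n k x t → weight (suc n) k x (+ 1) t ≡ weight n k x (+ 1) t + (t + + 1)
weight-suc n k x t = shift x t (+ n) (+ (n ℕ.+ k))
  where
  shift : ∀ x t N K → x + (+ 1 + N) * + 1 + t * (+ 1 + K) ≡ x + N * + 1 + t * K + (t + + 1)
  shift = solve-∀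

weight-suc-shift : ∀ n k x t → weight (suc n) k (x - t - + 1) (+ 1) t ≡ weight n k x (+ 1) t
weight-suc-shift n k x t = shift x t (+ n) (+ (n ℕ.+ k))
  where
  shift : ∀ x t N K → x - t - + 1 + (+ 1 + N) * + 1 + t * (+ 1 + K) ≡ x + N * + 1 + t * K
  shift = solve-∀

-- g and g′ are a coefficient at x and at x − s, with weights a + s and a there.
difference-step : ∀ s c a g g′ h h′ G H →
  g - g′ ≡ s * c * G → h - h′ ≡ s * c * H → g ≡ a * G + H →
  ((a + s) * g + h) - (a * g′ + h′) ≡ s * (+ 1 + c) * g
difference-step s c a g g′ h h′ G H Δg Δh g≡ = begin
  ((a + s) * g + h) - (a * g′ + h′)   ≡⟨ solve (s ∷ a ∷ g ∷ g′ ∷ h ∷ h′ ∷ []) ⟩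
  a * (g - g′) + (h - h′) + s * g     ≡⟨ cong₂ (λ u v → a * u + v + s * g) Δg Δh ⟩
  a * (s * c * G) + s * c * H + s * g ≡⟨ solve (s ∷ c ∷ a ∷ g ∷ G ∷ H ∷ []) ⟩
  s * c * (a * G + H) + s * g         ≡⟨ cong (λ u → s * c * u + s * g) (sym g≡) ⟩
  s * c * g + s * g                   ≡⟨ solve (s ∷ c ∷ g ∷ []) ⟩
  s * (+ 1 + c) * g                   ∎

Q₂-difference : ∀ k x t →
  Qnk 2 k x t - Qnk 2 k (x - t - + 1) t ≡ (t + + 1) * + (1 ℕ.+ k) * Qnk 1 k x t
Q₂-difference zero x t = begin
  Qnk 2 0 x t - Qnk 2 0 (x - t - + 1) t
    ≡⟨ cong₂ _-_ (Qnk-suc 0 0 x t) (Qnk-suc 0 0 (x - t - + 1) t) ⟩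
  (weight 1 0 x (+ 1) t * + 1 + + 0) - (weight 1 0 (x - t - + 1) (+ 1) t * + 1 + + 0)
    ≡⟨ cong₂ (λ u v → (u * + 1 + + 0) - (v * + 1 + + 0)) (weight-suc 0 0 x t) (weight-suc-shift 0 0 x t) ⟩
  ((a + (t + + 1)) * + 1 + + 0) - (a * + 1 + + 0)
    ≡⟨ cancel a (t + + 1) ⟩
  (t + + 1) * + 1 * + 1 ∎
  where
  a = weight 0 0 x (+ 1) t
  cancel : ∀ a s → ((a + s) * + 1 + + 0) - (a * + 1 + + 0) ≡ s * + 1 * + 1
  cancel = solve-∀
Q₂-difference (suc zero)    x t = sym (ℤ.*-zeroʳ ((t + + 1) * + 2))
Q₂-difference (suc (suc k)) x t = sym (ℤ.*-zeroʳ ((t + + 1) * + (3 ℕ.+ k)))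

Qnk-difference : ∀ m k x t →
  Qnk (suc (suc m)) k x t - Qnk (suc (suc m)) k (x - t - + 1) t ≡ (t + + 1) * + (suc m ℕ.+ k) * Qnk (suc m) k x t
Qnk-difference zero    k x t = Q₂-difference k x t
Qnk-difference (suc m) k x t = begin
  Qnk (3 ℕ.+ m) k x t - Qnk (3 ℕ.+ m) k x′ t
    ≡⟨ cong₂ _-_ (Qnk-suc (suc m) k x t) (Qnk-suc (suc m) k x′ t) ⟩
  (weight (2 ℕ.+ m) k x (+ 1) t * g + h) - (weight (2 ℕ.+ m) k x′ (+ 1) t * g′ + h′)
    ≡⟨ cong₂ (λ u v → (u * g + h) - (v * g′ + h′)) (weight-suc (suc m) k x t) (weight-suc-shift (suc m) k x t) ⟩
  ((a + s) * g + h) - (a * g′ + h′)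
    ≡⟨ difference-step s (+ (suc m ℕ.+ k)) a g g′ h h′ (Qnk (suc m) k x t) (lowerTerm (suc m) k x t)
         (Qnk-difference m k x t) (lowerTerm-difference k) (Qnk-suc m k x t) ⟩
  s * + (suc (suc m) ℕ.+ k) * g ∎
  where
  s = t + + 1
  x′ = x - t - + 1
  a = weight (suc m) k x (+ 1) t
  g = Qnk (2 ℕ.+ m) k x t
  g′ = Qnk (2 ℕ.+ m) k x′ t
  h = lowerTerm (2 ℕ.+ m) k x t
  h′ = lowerTerm (2 ℕ.+ m) k x′ t
  lowerTerm-difference : ∀ k →
    lowerTerm (2 ℕ.+ m) k x t - lowerTerm (2 ℕ.+ m) k x′ t ≡ s * + (suc m ℕ.+ k) * lowerTerm (suc m) k x t
  lowerTerm-difference zero    = sym (ℤ.*-zeroʳ (s * + (suc m ℕ.+ 0)))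
  lowerTerm-difference (suc j) = begin
    + (2 ℕ.+ m ℕ.+ j) * Qnk (2 ℕ.+ m) j x t - + (2 ℕ.+ m ℕ.+ j) * Qnk (2 ℕ.+ m) j x′ t
      ≡⟨ factor (+ (2 ℕ.+ m ℕ.+ j)) (Qnk (2 ℕ.+ m) j x t) (Qnk (2 ℕ.+ m) j x′ t) ⟩
    + (2 ℕ.+ m ℕ.+ j) * (Qnk (2 ℕ.+ m) j x t - Qnk (2 ℕ.+ m) j x′ t)
      ≡⟨ cong₂ (λ i u → + i * u) (sym (ℕ.+-suc (suc m) j)) (Qnk-difference m j x t) ⟩
    + (suc m ℕ.+ suc j) * (s * + (suc m ℕ.+ j) * Qnk (suc m) j x t)
      ≡⟨ reassociate (+ (suc m ℕ.+ suc j)) s (+ (suc m ℕ.+ j)) (Qnk (suc m) j x t) ⟩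
    s * + (suc m ℕ.+ suc j) * (+ (suc m ℕ.+ j) * Qnk (suc m) j x t) ∎
    where
    factor : ∀ i u v → i * u - i * v ≡ i * (u - v)
    factor = solve-∀
    reassociate : ∀ i s j q → i * (s * j * q) ≡ s * i * (j * q)
    reassociate = solve-∀

lemma6p2 : (n k : ℕ) → 2 ≤ n → k ≤ n ∸ 1 → (x t : ℤ) →
    Qnk n k x t - Qnk n k (x - t - + 1) t ≡ (t + + 1) * (+ (n Data.Nat.+ k ∸ 1)) * Qnk (n ∸ 1) k x t
lemma6p2 (suc (suc m)) k (s≤s (s≤s _)) _ x t = Qnk-difference m k x t
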